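{- Let $d\ge1$, let $\beta\in\mathbb F$, and let $\theta_0,\dots,\theta_d\in\mathbb F$ be mutually distinct and $\beta$-recurrent, i.e. $\theta_{i-2}-(\beta+1)\theta_{i-1}+(\beta+1)\theta_i-\theta_{i+1}=0$ for $2\le i\le d-1$. Then for scalars $\vartheta_0,\dots,\vartheta_{d+1}\in\mathbb F$ the following are equivalent: (i) $\displaystyle\vartheta_i=\vartheta_1\sum_{h=0}^{i-1}\frac{\theta_h-\theta_{d-h}}{\theta_0-\theta_d}$ for $0\le i\le d+1$; (ii) the sequence $\{\vartheta_i\}_{i=0}^{d+1}$ is $\beta$-recurrent, i.e. $\vartheta_{i-2}-(\beta+1)\vartheta_{i-1}+(\beta+1)\vartheta_i-\vartheta_{i+1}=0$ for $2\le i\le d$, and $\vartheta_0=0$, $\vartheta_1=\vartheta_d$, $\vartheta_{d+1}=0$.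
   Context: $\mathbb F$ is a field. -}

module Defs where

open import Level using (_⊔_) renaming (suc to lsuc)
open import Data.Nat using (ℕ; zero; suc; _∸_; _≤_)
open import Relation.Nullary using (¬_)
open import Relation.Binary.PropositionalEquality using (_≢_)
open import Algebra.Bundles using (CommutativeRing)

-- The inverse is given as a total function
-- _⁻¹ whose value on 0 is unconstrained (as in Lean/Mathlib).
record Field c ℓ : Set (lsuc (c ⊔ ℓ)) where
  field
    commutativeRing : CommutativeRing c ℓ
  open CommutativeRing commutativeRing public
  field
    0≉1      : ¬ (0# ≈ 1#)
    _⁻¹      : Carrier → Carrier
    inverseʳ : ∀ x → ¬ (x ≈ 0#) → x * (x ⁻¹) ≈ 1#

  infixl 7 _/_
  _/_ : Carrier → Carrier → Carrier
  x / y = x * (y ⁻¹)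

  sumTo : ℕ → (ℕ → Carrier) → Carrier
  sumTo zero    f = 0#
  sumTo (suc n) f = sumTo n f + f n

  MutuallyDistinct : ℕ → (ℕ → Carrier) → Set ℓ
  MutuallyDistinct d θ = ∀ i j → i ≤ d → j ≤ d → i ≢ j → ¬ (θ i ≈ θ j)

  BetaRecurrentUpTo : Carrier → ℕ → (ℕ → Carrier) → Set ℓ
  BetaRecurrentUpTo β m s =
    ∀ i → 2 ≤ i → i ≤ m →
      s (i ∸ 2) - (β + 1#) * s (i ∸ 1) + (β + 1#) * s i - s (suc i) ≈ 0#

module Submission where

open import Defs
open import Data.Nat using (ℕ; zero; suc; _∸_; _≤_; z≤n; s≤s)
import Data.Nat as ℕ
import Data.Nat.Properties as ℕP
open import Data.Integer as ℤ using (ℤ; +_; -[1+_])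
import Data.Integer.Properties as ℤP
import Data.Sign as Sign
open import Data.Maybe using (Maybe; just; nothing)
open import Data.Product using (_×_; _,_; proj₂)
open import Function.Base using (_∘_)
open import Function.Bundles using (_⇔_; mk⇔)
open import Algebra.Bundles using (CommutativeRing)
open import Relation.Nullary using (¬_; yes; no)
import Relation.Binary.PropositionalEquality as ≡

-- With γ the common value of θ_{h-1} - β θ_h + θ_{h+1}, the reversed sequence
-- θ_{d-h} has the same γ, so the summands c_h of (i) satisfy
-- c_{h-1} - β c_h + c_{h+1} = 0 and their partial sums S_i are β-recurrent, with
-- S_0 = 0, S_1 = S_d = 1 and S_{d+1} = 0 (the summands are antisymmetric under
-- h ↦ d - h).  This gives (i) ⇒ (ii).
--
-- Conversely ψ_i = ϑ_i - ϑ_1 S_i is β-recurrent and vanishes at 0, 1, d, d+1.  A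
-- β-recurrent sequence is determined by its first three terms, so it suffices to
-- show ψ_2 = 0.  The Casoratian
--   (ψ_{j+1} - ψ_j) θ_{j+1} - (ψ_{j+2} - ψ_{j+1}) θ_j - γ ψ_{j+1}
-- of ψ against θ does not depend on j; comparing j = 0 with j = d - 1, and using
-- ψ_{d-1} = ψ_2 (constancy of ψ_{j-1} - β ψ_j + ψ_{j+1}), gives
-- ψ_2 (θ_0 - θ_d) = 0.

-- The canonical map ℤ → R is a ring morphism, so the ring solver with integer
-- coefficients applies to any commutative ring.
module ℤ-Solver {c ℓ} (R : CommutativeRing c ℓ) where
  open CommutativeRing R
  open import Algebra.Properties.Semiring.Mult.TCOptimised semiring
    using (1+×; ×-homo-+; ×1-homo-*) renaming (_×_ to _×ℕ_)
  open import Algebra.Properties.Ring ring using (-‿distribˡ-*; -‿distribʳ-*)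
  open import Algebra.Properties.AbelianGroup +-abelianGroup
    using (ε⁻¹≈ε; ⁻¹-involutive; ⁻¹-∙-comm)
  open import Algebra.Solver.Ring.AlmostCommutativeRing
  open import Relation.Binary.Reasoning.Setoid setoid

  fromℕ : ℕ → Carrier
  fromℕ n = n ×ℕ 1#

  fromℤ : ℤ → Carrier
  fromℤ (+ n)    = fromℕ n
  fromℤ -[1+ n ] = - fromℕ (suc n)

  x-y≈[a+x]-[a+y] : ∀ a x y → x - y ≈ (a + x) - (a + y)
  x-y≈[a+x]-[a+y] a x y = begin
    x - y                      ≈⟨ +-identityˡ _ ⟨
    0# + (x - y)               ≈⟨ +-congʳ (-‿inverseʳ a) ⟨
    (a - a) + (x - y)          ≈⟨ +-assoc _ _ _ ⟩
    a + (- a + (x - y))        ≈⟨ +-congˡ (+-assoc _ _ _) ⟨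
    a + ((- a + x) - y)        ≈⟨ +-congˡ (+-congʳ (+-comm _ _)) ⟩
    a + ((x - a) - y)          ≈⟨ +-congˡ (+-assoc _ _ _) ⟩
    a + (x + (- a + - y))      ≈⟨ +-assoc _ _ _ ⟨
    (a + x) + (- a + - y)      ≈⟨ +-congˡ (⁻¹-∙-comm a y) ⟩
    (a + x) - (a + y)          ∎

  fromℤ-⊖ : ∀ m n → fromℤ (m ℤ.⊖ n) ≈ fromℕ m - fromℕ n
  fromℤ-⊖ zero    zero    = sym (-‿inverseʳ 0#)
  fromℤ-⊖ (suc m) zero    = sym (trans (+-congˡ ε⁻¹≈ε) (+-identityʳ _))
  fromℤ-⊖ zero    (suc n) = sym (+-identityˡ _)
  fromℤ-⊖ (suc m) (suc n) = begin
    fromℤ (suc m ℤ.⊖ suc n)          ≡⟨ ≡.cong fromℤ (ℤP.[1+m]⊖[1+n]≡m⊖n m n) ⟩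
    fromℤ (m ℤ.⊖ n)                  ≈⟨ fromℤ-⊖ m n ⟩
    fromℕ m - fromℕ n                ≈⟨ x-y≈[a+x]-[a+y] 1# (fromℕ m) (fromℕ n) ⟩
    (1# + fromℕ m) - (1# + fromℕ n)  ≈⟨ +-cong (1+× m 1#) (-‿cong (1+× n 1#)) ⟨
    fromℕ (suc m) - fromℕ (suc n)    ∎

  fromℤ-neg : ∀ i → fromℤ (ℤ.- i) ≈ - fromℤ i
  fromℤ-neg (+ zero)  = sym ε⁻¹≈ε
  fromℤ-neg (+ suc n) = refl
  fromℤ-neg -[1+ n ]  = sym (⁻¹-involutive _)

  fromℤ-+ : ∀ i j → fromℤ (i ℤ.+ j) ≈ fromℤ i + fromℤ j
  fromℤ-+ -[1+ m ] -[1+ n ] = begin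
    - fromℕ (suc (suc (m ℕ.+ n)))       ≡⟨ ≡.cong (λ k → - fromℕ (suc k)) (ℕP.+-suc m n) ⟨
    - fromℕ (suc m ℕ.+ suc n)           ≈⟨ -‿cong (×-homo-+ 1# (suc m) (suc n)) ⟩
    - (fromℕ (suc m) + fromℕ (suc n))   ≈⟨ ⁻¹-∙-comm _ _ ⟨
    - fromℕ (suc m) - fromℕ (suc n)     ∎
  fromℤ-+ -[1+ m ] (+ n)    = trans (fromℤ-⊖ n (suc m)) (+-comm _ _)
  fromℤ-+ (+ m)    -[1+ n ] = fromℤ-⊖ m (suc n)
  fromℤ-+ (+ m)    (+ n)    = ×-homo-+ 1# m n

  fromℤ-+◃ : ∀ n → fromℤ (Sign.+ ℤ.◃ n) ≈ fromℕ n
  fromℤ-+◃ zero    = refl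
  fromℤ-+◃ (suc n) = refl

  fromℤ--◃ : ∀ n → fromℤ (Sign.- ℤ.◃ n) ≈ - fromℕ n
  fromℤ--◃ zero    = sym ε⁻¹≈ε
  fromℤ--◃ (suc n) = refl

  fromℤ-* : ∀ i j → fromℤ (i ℤ.* j) ≈ fromℤ i * fromℤ j
  fromℤ-* (+ m) (+ n) = trans (fromℤ-+◃ (m ℕ.* n)) (×1-homo-* m n)
  fromℤ-* (+ m) -[1+ n ] = begin
    fromℤ (Sign.- ℤ.◃ (m ℕ.* suc n))  ≈⟨ fromℤ--◃ (m ℕ.* suc n) ⟩
    - fromℕ (m ℕ.* suc n)            ≈⟨ -‿cong (×1-homo-* m (suc n)) ⟩
    - (fromℕ m * fromℕ (suc n))      ≈⟨ -‿distribʳ-* _ _ ⟩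
    fromℕ m * - fromℕ (suc n)        ∎
  fromℤ-* -[1+ m ] (+ n) = begin
    fromℤ (Sign.- ℤ.◃ (suc m ℕ.* n))  ≈⟨ fromℤ--◃ (suc m ℕ.* n) ⟩
    - fromℕ (suc m ℕ.* n)            ≈⟨ -‿cong (×1-homo-* (suc m) n) ⟩
    - (fromℕ (suc m) * fromℕ n)      ≈⟨ -‿distribˡ-* _ _ ⟩
    - fromℕ (suc m) * fromℕ n        ∎
  fromℤ-* -[1+ m ] -[1+ n ] = begin
    fromℤ (Sign.+ ℤ.◃ (suc m ℕ.* suc n))   ≈⟨ fromℤ-+◃ (suc m ℕ.* suc n) ⟩
    fromℕ (suc m ℕ.* suc n)               ≈⟨ ×1-homo-* (suc m) (suc n) ⟩
    fromℕ (suc m) * fromℕ (suc n)         ≈⟨ ⁻¹-involutive _ ⟨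
    - - (fromℕ (suc m) * fromℕ (suc n))   ≈⟨ -‿cong (-‿distribˡ-* _ _) ⟩
    - (- fromℕ (suc m) * fromℕ (suc n))   ≈⟨ -‿distribʳ-* _ _ ⟩
    - fromℕ (suc m) * - fromℕ (suc n)     ∎

  fromℤ-morphism : ℤ.+-*-rawRing -Raw-AlmostCommutative⟶ fromCommutativeRing R
  fromℤ-morphism = record
    { ⟦_⟧    = fromℤ
    ; +-homo = fromℤ-+
    ; *-homo = fromℤ-*
    ; -‿homo = fromℤ-neg
    ; 0-homo = refl
    ; 1-homo = refl
    }

  fromℤ-≟ : ∀ i j → Maybe (fromℤ i ≈ fromℤ j)
  fromℤ-≟ i j with i ℤ.≟ j
  ... | yes ≡.refl = just refl
  ... | no _       = nothing

  open import Algebra.Solver.Ring ℤ.+-*-rawRing (fromCommutativeRing R) fromℤ-morphism fromℤ-≟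
    public

module Recurrence {c ℓ} (F : Field c ℓ) where
  open Field F
  open ℤ-Solver commutativeRing using (solve; _:=_; _:+_; _:-_; _:*_; :-_; con)
  open import Algebra.Properties.Ring ring using (-‿distribˡ-*; x[y-z]≈xy-xz)
  open import Algebra.Properties.AbelianGroup +-abelianGroup
    using (ε⁻¹≈ε; ⁻¹-injective; ⁻¹-anti-homo‿-)
    renaming (x∙y⁻¹≈ε⇒x≈y to x-y≈0⇒x≈y; x≈y⇒x∙y⁻¹≈ε to x≈y⇒x-y≈0)
  open import Relation.Binary.Reasoning.Setoid setoid

  x-0#≈x : ∀ x → x - 0# ≈ x
  x-0#≈x x = trans (+-congˡ ε⁻¹≈ε) (+-identityʳ x)

  -x≈0⇒x≈0 : ∀ {x} → - x ≈ 0# → x ≈ 0#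
  -x≈0⇒x≈0 -x≈0 = ⁻¹-injective (trans -x≈0 (sym ε⁻¹≈ε))

  x*y≈0⇒x≈0 : ∀ {x y} → ¬ y ≈ 0# → x * y ≈ 0# → x ≈ 0#
  x*y≈0⇒x≈0 {x} {y} y≉0 xy≈0 = begin
    x               ≈⟨ *-identityʳ x ⟨
    x * 1#          ≈⟨ *-congˡ (inverseʳ y y≉0) ⟨
    x * (y * y ⁻¹)  ≈⟨ *-assoc x y _ ⟨
    x * y * y ⁻¹    ≈⟨ *-congʳ xy≈0 ⟩
    0# * y ⁻¹       ≈⟨ zeroˡ _ ⟩
    0#              ∎

  x*y≈x*z⇒x≈0 : ∀ {x y z} → ¬ y ≈ z → x * y ≈ x * z → x ≈ 0#
  x*y≈x*z⇒x≈0 {x} {y} {z} y≉z xy≈xz =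
    x*y≈0⇒x≈0 (λ y-z≈0 → y≉z (x-y≈0⇒x≈y y z y-z≈0))
              (trans (x[y-z]≈xy-xz x y z) (x≈y⇒x-y≈0 xy≈xz))

  sumTo-suc : ∀ n f → sumTo (suc n) f ≈ f 0 + sumTo n (λ h → f (suc h))
  sumTo-suc zero    f = +-comm 0# (f 0)
  sumTo-suc (suc n) f = trans (+-congʳ (sumTo-suc n f)) (+-assoc _ _ _)

  sumTo-reverse : ∀ n f → sumTo (suc n) (λ h → f (n ∸ h)) ≈ sumTo (suc n) f
  sumTo-reverse zero    f = refl
  sumTo-reverse (suc n) f = begin
    sumTo (suc (suc n)) (λ h → f (suc n ∸ h))    ≈⟨ sumTo-suc (suc n) _ ⟩
    f (suc n) + sumTo (suc n) (λ h → f (n ∸ h))  ≈⟨ +-congˡ (sumTo-reverse n f) ⟩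
    f (suc n) + sumTo (suc n) f                  ≈⟨ +-comm _ _ ⟩
    sumTo (suc (suc n)) f                        ∎

  sumTo-[-]*ʳ : ∀ n f g t → sumTo n (λ h → (f h - g h) * t) ≈ (sumTo n f - sumTo n g) * t
  sumTo-[-]*ʳ zero    f g t = sym (trans (*-congʳ (-‿inverseʳ 0#)) (zeroˡ t))
  sumTo-[-]*ʳ (suc n) f g t =
    trans (+-congʳ (sumTo-[-]*ʳ n f g t)) (distribute (sumTo n f) (sumTo n g) (f n) (g n))
    where
    distribute : ∀ x y a b → (x - y) * t + (a - b) * t ≈ ((x + a) - (y + b)) * t
    distribute = solve 5 (λ t x y a b →
      (x :- y) :* t :+ (a :- b) :* t := ((x :+ a) :- (y :+ b)) :* t) refl t

  casoratianExpr : Carrier → Carrier → Carrier → Carrier → Carrier → Carrier → Carrier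
  casoratianExpr γ p₀ p₁ p₂ q₀ q₁ = (p₁ - p₀) * q₁ - (p₂ - p₁) * q₀ - γ * p₁

  casoratian : Carrier → (ℕ → Carrier) → (ℕ → Carrier) → ℕ → Carrier
  casoratian γ ψ θ j = casoratianExpr γ (ψ j) (ψ (suc j)) (ψ (suc (suc j))) (θ j) (θ (suc j))

  casoratianExpr-cong : ∀ {γ p₀ p₁ p₂ p₀′ p₁′ p₂′} q₀ q₁ → p₀ ≈ p₀′ → p₁ ≈ p₁′ → p₂ ≈ p₂′ →
                        casoratianExpr γ p₀ p₁ p₂ q₀ q₁ ≈ casoratianExpr γ p₀′ p₁′ p₂′ q₀ q₁
  casoratianExpr-cong q₀ q₁ e₀ e₁ e₂ =
    +-cong (+-cong (*-congʳ (+-cong e₁ (-‿cong e₀))) (-‿cong (*-congʳ (+-cong e₂ (-‿cong e₁)))))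
           (-‿cong (*-congˡ e₁))

  casoratianExpr-zerosˡ : ∀ γ p q₀ q₁ → casoratianExpr γ 0# 0# p q₀ q₁ ≈ - (p * q₀)
  casoratianExpr-zerosˡ = solve 4 (λ γ p q₀ q₁ →
    (con (+ 0) :- con (+ 0)) :* q₁ :- (p :- con (+ 0)) :* q₀ :- γ :* con (+ 0) := :- (p :* q₀)) refl

  casoratianExpr-zerosʳ : ∀ γ p q₀ q₁ → casoratianExpr γ p 0# 0# q₀ q₁ ≈ - (p * q₁)
  casoratianExpr-zerosʳ = solve 4 (λ γ p q₀ q₁ →
    (con (+ 0) :- p) :* q₁ :- (con (+ 0) :- con (+ 0)) :* q₀ :- γ :* con (+ 0) := :- (p :* q₁)) refl

  module _ (β : Carrier) where

    betaExpr : Carrier → Carrier → Carrier → Carrier → Carrier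
    betaExpr x₀ x₁ x₂ x₃ = x₀ - (β + 1#) * x₁ + (β + 1#) * x₂ - x₃

    gammaExpr : Carrier → Carrier → Carrier → Carrier
    gammaExpr x₀ x₁ x₂ = x₂ - β * x₁ + x₀

    betaAt : (ℕ → Carrier) → ℕ → Carrier
    betaAt s k = betaExpr (s k) (s (suc k)) (s (suc (suc k))) (s (suc (suc (suc k))))

    gammaAt : (ℕ → Carrier) → ℕ → Carrier
    gammaAt s k = gammaExpr (s k) (s (suc k)) (s (suc (suc k)))

    BetaGammaRecurrentUpTo : Carrier → ℕ → (ℕ → Carrier) → Set ℓ
    BetaGammaRecurrentUpTo γ m s = ∀ k → suc (suc k) ≤ m → gammaAt s k ≈ γ

    betaRecurrent-at : ∀ {m s k} → BetaRecurrentUpTo β m s → suc (suc k) ≤ m → betaAt s k ≈ 0#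
    betaRecurrent-at rec = rec _ (s≤s (s≤s z≤n))

    betaRecurrent-intro : ∀ {m s} → (∀ k → suc (suc k) ≤ m → betaAt s k ≈ 0#) →
                          BetaRecurrentUpTo β m s
    betaRecurrent-intro h (suc (suc k)) _ = h k
    betaRecurrent-intro h (suc zero) (s≤s ())

    betaExpr-cong : ∀ {x₀ x₁ x₂ x₃ y₀ y₁ y₂ y₃} → x₀ ≈ y₀ → x₁ ≈ y₁ → x₂ ≈ y₂ → x₃ ≈ y₃ →
                    betaExpr x₀ x₁ x₂ x₃ ≈ betaExpr y₀ y₁ y₂ y₃
    betaExpr-cong e₀ e₁ e₂ e₃ =
      +-cong (+-cong (+-cong e₀ (-‿cong (*-congˡ e₁))) (*-congˡ e₂)) (-‿cong e₃)

    gammaExpr-cong : ∀ {x₀ x₁ x₂ y₀ y₁ y₂} → x₀ ≈ y₀ → x₁ ≈ y₁ → x₂ ≈ y₂ →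
                     gammaExpr x₀ x₁ x₂ ≈ gammaExpr y₀ y₁ y₂
    gammaExpr-cong e₀ e₁ e₂ = +-cong (+-cong e₂ (-‿cong (*-congˡ e₁))) e₀

    gammaExpr-sym : ∀ x₀ x₁ x₂ → gammaExpr x₀ x₁ x₂ ≈ gammaExpr x₂ x₁ x₀
    gammaExpr-sym = solve 4 (λ b x₀ x₁ x₂ →
      x₂ :- b :* x₁ :+ x₀ := x₀ :- b :* x₁ :+ x₂) refl β

    gammaExpr-step : ∀ x₀ x₁ x₂ x₃ → betaExpr x₀ x₁ x₂ x₃ ≈ 0# →
                     gammaExpr x₁ x₂ x₃ ≈ gammaExpr x₀ x₁ x₂
    gammaExpr-step x₀ x₁ x₂ x₃ b≈0 = begin
      gammaExpr x₁ x₂ x₃                             ≈⟨ identity x₀ x₁ x₂ x₃ ⟩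
      gammaExpr x₀ x₁ x₂ - betaExpr x₀ x₁ x₂ x₃      ≈⟨ +-congˡ (-‿cong b≈0) ⟩
      gammaExpr x₀ x₁ x₂ - 0#                        ≈⟨ x-0#≈x _ ⟩
      gammaExpr x₀ x₁ x₂                             ∎
      where
      identity : ∀ x₀ x₁ x₂ x₃ → gammaExpr x₁ x₂ x₃ ≈ gammaExpr x₀ x₁ x₂ - betaExpr x₀ x₁ x₂ x₃
      identity = solve 5 (λ b x₀ x₁ x₂ x₃ →
        x₃ :- b :* x₂ :+ x₁
          := (x₂ :- b :* x₁ :+ x₀)
             :- (x₀ :- (b :+ con (+ 1)) :* x₁ :+ (b :+ con (+ 1)) :* x₂ :- x₃)) refl β

    betaRecurrent⇒betaGammaRecurrent : ∀ {m s} → BetaRecurrentUpTo β m s →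
                                       BetaGammaRecurrentUpTo (gammaAt s 0) (suc m) s
    betaRecurrent⇒betaGammaRecurrent rec zero    _        = refl
    betaRecurrent⇒betaGammaRecurrent rec (suc k) (s≤s le) =
      trans (gammaExpr-step _ _ _ _ (betaRecurrent-at rec le))
            (betaRecurrent⇒betaGammaRecurrent rec k (ℕP.m≤n⇒m≤1+n le))

    betaRecurrent-cong : ∀ {m s t} → (∀ i → i ≤ suc m → s i ≈ t i) →
                         BetaRecurrentUpTo β m s → BetaRecurrentUpTo β m t
    betaRecurrent-cong {m} {s} {t} s≈t rec = betaRecurrent-intro step
      where
      step : ∀ k → suc (suc k) ≤ m → betaAt t k ≈ 0#
      step k le = trans (betaExpr-cong (t≈s k (ℕP.m≤n+m k 3)) (t≈s (suc k) (ℕP.m≤n+m (suc k) 2))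
                                       (t≈s (suc (suc k)) (ℕP.m≤n+m (suc (suc k)) 1)) (t≈s _ ℕP.≤-refl))
                        (betaRecurrent-at rec le)
        where
        t≈s : ∀ j → j ≤ suc (suc (suc k)) → t j ≈ s j
        t≈s j j≤ = sym (s≈t j (ℕP.≤-trans j≤ (s≤s le)))

    betaRecurrent-* : ∀ {m s} a → BetaRecurrentUpTo β m s → BetaRecurrentUpTo β m (λ i → a * s i)
    betaRecurrent-* {s = s} a rec = betaRecurrent-intro λ k le → begin
      betaAt (λ i → a * s i) k  ≈⟨ identity a (s k) (s (suc k)) (s (suc (suc k))) _ ⟩
      a * betaAt s k            ≈⟨ *-congˡ (betaRecurrent-at rec le) ⟩
      a * 0#                    ≈⟨ zeroʳ a ⟩
      0#                        ∎
      where
      identity : ∀ a x₀ x₁ x₂ x₃ →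
                 betaExpr (a * x₀) (a * x₁) (a * x₂) (a * x₃) ≈ a * betaExpr x₀ x₁ x₂ x₃
      identity = solve 6 (λ b a x₀ x₁ x₂ x₃ →
        a :* x₀ :- (b :+ con (+ 1)) :* (a :* x₁) :+ (b :+ con (+ 1)) :* (a :* x₂) :- a :* x₃
          := a :* (x₀ :- (b :+ con (+ 1)) :* x₁ :+ (b :+ con (+ 1)) :* x₂ :- x₃)) refl β

    betaRecurrent-- : ∀ {m s t} → BetaRecurrentUpTo β m s → BetaRecurrentUpTo β m t →
                      BetaRecurrentUpTo β m (λ i → s i - t i)
    betaRecurrent-- {s = s} {t} s-rec t-rec = betaRecurrent-intro λ k le → begin
      betaAt (λ i → s i - t i) k  ≈⟨ identity (s k) (s (suc k)) (s (suc (suc k))) _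
                                               (t k) (t (suc k)) (t (suc (suc k))) _ ⟩
      betaAt s k - betaAt t k     ≈⟨ +-cong (betaRecurrent-at s-rec le) (-‿cong (betaRecurrent-at t-rec le)) ⟩
      0# - 0#                     ≈⟨ -‿inverseʳ 0# ⟩
      0#                          ∎
      where
      identity : ∀ x₀ x₁ x₂ x₃ y₀ y₁ y₂ y₃ →
                 betaExpr (x₀ - y₀) (x₁ - y₁) (x₂ - y₂) (x₃ - y₃)
                   ≈ betaExpr x₀ x₁ x₂ x₃ - betaExpr y₀ y₁ y₂ y₃
      identity = solve 9 (λ b x₀ x₁ x₂ x₃ y₀ y₁ y₂ y₃ →
        (x₀ :- y₀) :- (b :+ con (+ 1)) :* (x₁ :- y₁) :+ (b :+ con (+ 1)) :* (x₂ :- y₂) :- (x₃ :- y₃)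
          := (x₀ :- (b :+ con (+ 1)) :* x₁ :+ (b :+ con (+ 1)) :* x₂ :- x₃)
             :- (y₀ :- (b :+ con (+ 1)) :* y₁ :+ (b :+ con (+ 1)) :* y₂ :- y₃)) refl β

    sumTo-betaRecurrent : ∀ {m c} → BetaGammaRecurrentUpTo 0# m c →
                          BetaRecurrentUpTo β m (λ i → sumTo i c)
    sumTo-betaRecurrent {c = c} c-rec = betaRecurrent-intro λ k le → begin
      betaAt (λ i → sumTo i c) k  ≈⟨ identity (sumTo k c) (c k) (c (suc k)) (c (suc (suc k))) ⟩
      - gammaAt c k               ≈⟨ -‿cong (c-rec k le) ⟩
      - 0#                        ≈⟨ ε⁻¹≈ε ⟩
      0#                          ∎
      where
      identity : ∀ s c₀ c₁ c₂ →
                 betaExpr s (s + c₀) (s + c₀ + c₁) (s + c₀ + c₁ + c₂) ≈ - gammaExpr c₀ c₁ c₂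
      identity = solve 5 (λ b s c₀ c₁ c₂ →
        s :- (b :+ con (+ 1)) :* (s :+ c₀) :+ (b :+ con (+ 1)) :* (s :+ c₀ :+ c₁)
          :- (s :+ c₀ :+ c₁ :+ c₂)
          := :- (c₂ :- b :* c₁ :+ c₀)) refl β

    betaRecurrent-vanish : ∀ {m ψ} → BetaRecurrentUpTo β m ψ → ψ 0 ≈ 0# → ψ 1 ≈ 0# → ψ 2 ≈ 0# →
                           ∀ i → i ≤ suc m → ψ i ≈ 0#
    betaRecurrent-vanish {m} {ψ} rec ψ₀ ψ₁ ψ₂ = vanish
      where
      zeros : ∀ x → betaExpr 0# 0# 0# x ≈ - x
      zeros = solve 2 (λ b x →
        con (+ 0) :- (b :+ con (+ 1)) :* con (+ 0) :+ (b :+ con (+ 1)) :* con (+ 0) :- x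
          := :- x) refl β

      window : ∀ k → suc (suc k) ≤ suc m → ψ k ≈ 0# × ψ (suc k) ≈ 0# × ψ (suc (suc k)) ≈ 0#
      window zero    _        = ψ₀ , ψ₁ , ψ₂
      window (suc k) (s≤s le) with window k (ℕP.m≤n⇒m≤1+n le)
      ... | z₀ , z₁ , z₂ = z₁ , z₂ , -x≈0⇒x≈0 (begin
        - ψ (suc (suc (suc k)))                   ≈⟨ zeros _ ⟨
        betaExpr 0# 0# 0# (ψ (suc (suc (suc k))))  ≈⟨ betaExpr-cong (sym z₀) (sym z₁) (sym z₂) refl ⟩
        betaAt ψ k                                 ≈⟨ betaRecurrent-at rec le ⟩
        0#                                         ∎)

      vanish : ∀ i → i ≤ suc m → ψ i ≈ 0#
      vanish zero          _  = ψ₀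
      vanish (suc zero)    _  = ψ₁
      vanish (suc (suc k)) le = proj₂ (proj₂ (window k le))

    casoratianExpr-step : ∀ γ p₀ p₁ p₂ p₃ q₀ q₁ q₂ →
                          gammaExpr q₀ q₁ q₂ ≈ γ → betaExpr p₀ p₁ p₂ p₃ ≈ 0# →
                          casoratianExpr γ p₁ p₂ p₃ q₁ q₂ ≈ casoratianExpr γ p₀ p₁ p₂ q₀ q₁
    casoratianExpr-step γ p₀ p₁ p₂ p₃ q₀ q₁ q₂ g≈γ b≈0 = begin
      casoratianExpr γ p₁ p₂ p₃ q₁ q₂
        ≈⟨ identity γ p₀ p₁ p₂ p₃ q₀ q₁ q₂ ⟩
      casoratianExpr γ p₀ p₁ p₂ q₀ q₁ + (p₂ - p₁) * (gammaExpr q₀ q₁ q₂ - γ) + q₁ * betaExpr p₀ p₁ p₂ p₃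
        ≈⟨ +-cong (+-congˡ (*-congˡ (x≈y⇒x-y≈0 g≈γ))) (*-congˡ b≈0) ⟩
      casoratianExpr γ p₀ p₁ p₂ q₀ q₁ + (p₂ - p₁) * 0# + q₁ * 0#
        ≈⟨ +-cong (trans (+-congˡ (zeroʳ _)) (+-identityʳ _)) (zeroʳ q₁) ⟩
      casoratianExpr γ p₀ p₁ p₂ q₀ q₁ + 0#
        ≈⟨ +-identityʳ _ ⟩
      casoratianExpr γ p₀ p₁ p₂ q₀ q₁
        ∎
      where
      identity : ∀ γ p₀ p₁ p₂ p₃ q₀ q₁ q₂ →
                 casoratianExpr γ p₁ p₂ p₃ q₁ q₂
                   ≈ casoratianExpr γ p₀ p₁ p₂ q₀ q₁ + (p₂ - p₁) * (gammaExpr q₀ q₁ q₂ - γ)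
                     + q₁ * betaExpr p₀ p₁ p₂ p₃
      identity = solve 9 (λ b γ p₀ p₁ p₂ p₃ q₀ q₁ q₂ →
        (p₂ :- p₁) :* q₂ :- (p₃ :- p₂) :* q₁ :- γ :* p₂
          := (p₁ :- p₀) :* q₁ :- (p₂ :- p₁) :* q₀ :- γ :* p₁
             :+ (p₂ :- p₁) :* ((q₂ :- b :* q₁ :+ q₀) :- γ)
             :+ q₁ :* (p₀ :- (b :+ con (+ 1)) :* p₁ :+ (b :+ con (+ 1)) :* p₂ :- p₃)) refl β

    casoratian-const : ∀ {γ m θ ψ} → BetaGammaRecurrentUpTo γ m θ → BetaRecurrentUpTo β m ψ →
                       ∀ j → suc j ≤ m → casoratian γ ψ θ j ≈ casoratian γ ψ θ 0
    casoratian-const θ-rec ψ-rec zero    _  = refl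
    casoratian-const θ-rec ψ-rec (suc j) le =
      trans (casoratianExpr-step _ _ _ _ _ _ _ _ (θ-rec j le) (betaRecurrent-at ψ-rec le))
            (casoratian-const θ-rec ψ-rec j (ℕP.<⇒≤ le))

    betaRecurrent-boundary⇒ψ₂≈0 :
      ∀ {γ d θ ψ} → 1 ≤ d → BetaGammaRecurrentUpTo γ d θ → ¬ θ 0 ≈ θ d →
      BetaRecurrentUpTo β d ψ → ψ 0 ≈ 0# → ψ 1 ≈ 0# → ψ d ≈ 0# → ψ (suc d) ≈ 0# → ψ 2 ≈ 0#
    betaRecurrent-boundary⇒ψ₂≈0 {d = suc zero} _ _ _ _ _ _ _ ψd+1 = ψd+1
    betaRecurrent-boundary⇒ψ₂≈0 {γ} {d@(suc (suc e))} {θ} {ψ} _ θ-rec θ₀≉θd ψ-rec ψ₀ ψ₁ ψd ψd+1 =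
      x*y≈x*z⇒x≈0 θ₀≉θd (⁻¹-injective (begin
        - (ψ 2 * θ 0)
          ≈⟨ casoratianExpr-zerosˡ γ (ψ 2) (θ 0) (θ 1) ⟨
        casoratianExpr γ 0# 0# (ψ 2) (θ 0) (θ 1)
          ≈⟨ casoratianExpr-cong (θ 0) (θ 1) (sym ψ₀) (sym ψ₁) refl ⟩
        casoratian γ ψ θ 0
          ≈⟨ casoratian-const θ-rec ψ-rec (suc e) ℕP.≤-refl ⟨
        casoratian γ ψ θ (suc e)
          ≈⟨ casoratianExpr-cong (θ (suc e)) (θ d) refl ψd ψd+1 ⟩
        casoratianExpr γ (ψ (suc e)) 0# 0# (θ (suc e)) (θ d)
          ≈⟨ casoratianExpr-zerosʳ γ (ψ (suc e)) (θ (suc e)) (θ d) ⟩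
        - (ψ (suc e) * θ d)
          ≈⟨ -‿cong (*-congʳ ψ[d-1]≈ψ₂) ⟩
        - (ψ 2 * θ d)
          ∎))
      where
      zerosˡ : ∀ x → gammaExpr 0# 0# x ≈ x
      zerosˡ = solve 2 (λ b x → x :- b :* con (+ 0) :+ con (+ 0) := x) refl β

      ψ[d-1]≈ψ₂ : ψ (suc e) ≈ ψ 2
      ψ[d-1]≈ψ₂ = begin
        ψ (suc e)                    ≈⟨ zerosˡ _ ⟨
        gammaExpr 0# 0# (ψ (suc e))  ≈⟨ gammaExpr-sym _ _ _ ⟩
        gammaExpr (ψ (suc e)) 0# 0#  ≈⟨ gammaExpr-cong refl (sym ψd) (sym ψd+1) ⟩
        gammaAt ψ (suc e)            ≈⟨ betaRecurrent⇒betaGammaRecurrent ψ-rec (suc e) ℕP.≤-refl ⟩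
        gammaAt ψ 0                  ≈⟨ gammaExpr-cong ψ₀ ψ₁ refl ⟩
        gammaExpr 0# 0# (ψ 2)        ≈⟨ zerosˡ _ ⟩
        ψ 2                          ∎

    betaRecurrent-boundary-vanish :
      ∀ {γ d θ ψ} → 1 ≤ d → BetaGammaRecurrentUpTo γ d θ → ¬ θ 0 ≈ θ d →
      BetaRecurrentUpTo β d ψ → ψ 0 ≈ 0# → ψ 1 ≈ 0# → ψ d ≈ 0# → ψ (suc d) ≈ 0# →
      ∀ i → i ≤ suc d → ψ i ≈ 0#
    betaRecurrent-boundary-vanish 1≤d θ-rec θ₀≉θd ψ-rec ψ₀ ψ₁ ψd ψd+1 =
      betaRecurrent-vanish ψ-rec ψ₀ ψ₁ (betaRecurrent-boundary⇒ψ₂≈0 1≤d θ-rec θ₀≉θd ψ-rec ψ₀ ψ₁ ψd ψd+1)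

    gammaAt-reverse : ∀ {d s} k → suc (suc k) ≤ d →
                      gammaAt (λ h → s (d ∸ h)) k ≈ gammaAt s (d ∸ suc (suc k))
    gammaAt-reverse {suc (suc d)}     zero    _        = gammaExpr-sym _ _ _
    gammaAt-reverse {suc d}       {s} (suc k) (s≤s le) = gammaAt-reverse {d} {s} k le

    betaGammaRecurrent-reverse : ∀ {γ d s} → BetaGammaRecurrentUpTo γ d s →
                                 BetaGammaRecurrentUpTo γ d (λ h → s (d ∸ h))
    betaGammaRecurrent-reverse {s = s} rec k le =
      trans (gammaAt-reverse {s = s} k le) (rec _ (bound le))
      where
      bound : ∀ {k d} → suc (suc k) ≤ d → suc (suc (d ∸ suc (suc k))) ≤ d
      bound {k} {suc (suc d)} (s≤s (s≤s k≤d)) = s≤s (s≤s (ℕP.m∸n≤m d k))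

  module PartialSums (d : ℕ) (β : Carrier) (θ : ℕ → Carrier) (θ₀≉θd : ¬ θ 0 ≈ θ d)
                     (θ-rec : BetaRecurrentUpTo β (d ∸ 1) θ) where

    term : ℕ → Carrier
    term h = (θ h - θ (d ∸ h)) / (θ 0 - θ d)

    partialSum : ℕ → Carrier
    partialSum i = sumTo i term

    θ-betaGamma : BetaGammaRecurrentUpTo β (gammaAt β θ 0) d θ
    θ-betaGamma k le = betaRecurrent⇒betaGammaRecurrent β θ-rec k (ℕP.≤-trans le (ℕP.m≤n+m∸n d 1))

    term-betaGamma : BetaGammaRecurrentUpTo β 0# d term
    term-betaGamma k le = begin
      gammaAt β term k
        ≈⟨ identity (θ k) (θ (suc k)) (θ (suc (suc k))) _ _ _ _ ⟩
      (gammaAt β θ k - gammaAt β (λ h → θ (d ∸ h)) k) * (θ 0 - θ d) ⁻¹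
        ≈⟨ *-congʳ (x≈y⇒x-y≈0 (trans (θ-betaGamma k le)
                                     (sym (betaGammaRecurrent-reverse β θ-betaGamma k le)))) ⟩
      0# * (θ 0 - θ d) ⁻¹
        ≈⟨ zeroˡ _ ⟩
      0# ∎
      where
      identity : ∀ x₀ x₁ x₂ y₀ y₁ y₂ t →
                 gammaExpr β ((x₀ - y₀) * t) ((x₁ - y₁) * t) ((x₂ - y₂) * t)
                   ≈ (gammaExpr β x₀ x₁ x₂ - gammaExpr β y₀ y₁ y₂) * t
      identity = solve 8 (λ b x₀ x₁ x₂ y₀ y₁ y₂ t →
        (x₂ :- y₂) :* t :- b :* ((x₁ :- y₁) :* t) :+ (x₀ :- y₀) :* t
          := ((x₂ :- b :* x₁ :+ x₀) :- (y₂ :- b :* y₁ :+ y₀)) :* t) refl β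

    partialSum-betaRecurrent : BetaRecurrentUpTo β d partialSum
    partialSum-betaRecurrent = sumTo-betaRecurrent β term-betaGamma

    partialSum-1 : partialSum 1 ≈ 1#
    partialSum-1 = trans (+-identityˡ _) (inverseʳ _ (θ₀≉θd ∘ x-y≈0⇒x≈y _ _))

    partialSum-suc-d : partialSum (suc d) ≈ 0#
    partialSum-suc-d = begin
      sumTo (suc d) term
        ≈⟨ sumTo-[-]*ʳ (suc d) θ (λ h → θ (d ∸ h)) _ ⟩
      (sumTo (suc d) θ - sumTo (suc d) (λ h → θ (d ∸ h))) * (θ 0 - θ d) ⁻¹
        ≈⟨ *-congʳ (x≈y⇒x-y≈0 (sym (sumTo-reverse d θ))) ⟩
      0# * (θ 0 - θ d) ⁻¹
        ≈⟨ zeroˡ _ ⟩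
      0# ∎

    term-d : term d ≈ - 1#
    term-d = begin
      (θ d - θ (d ∸ d)) * (θ 0 - θ d) ⁻¹    ≡⟨ ≡.cong (λ j → (θ d - θ j) * (θ 0 - θ d) ⁻¹) (ℕP.n∸n≡0 d) ⟩
      (θ d - θ 0) * (θ 0 - θ d) ⁻¹          ≈⟨ *-congʳ (⁻¹-anti-homo‿- (θ 0) (θ d)) ⟨
      - (θ 0 - θ d) * (θ 0 - θ d) ⁻¹        ≈⟨ -‿distribˡ-* _ _ ⟨
      - ((θ 0 - θ d) * (θ 0 - θ d) ⁻¹)      ≈⟨ -‿cong (inverseʳ _ (θ₀≉θd ∘ x-y≈0⇒x≈y _ _)) ⟩
      - 1#                                  ∎

    partialSum-d : partialSum d ≈ 1#
    partialSum-d = x-y≈0⇒x≈y _ _ (trans (+-congˡ (sym term-d)) partialSum-suc-d)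

    scaledPartialSum⇒recurrent :
      ∀ ϑ → (∀ i → i ≤ suc d → ϑ i ≈ ϑ 1 * partialSum i) →
      BetaRecurrentUpTo β d ϑ × ϑ 0 ≈ 0# × ϑ 1 ≈ ϑ d × ϑ (suc d) ≈ 0#
    scaledPartialSum⇒recurrent ϑ ϑ≈ =
        betaRecurrent-cong β (λ i le → sym (ϑ≈ i le)) (betaRecurrent-* β (ϑ 1) partialSum-betaRecurrent)
      , trans (ϑ≈ 0 z≤n) (zeroʳ _)
      , sym (trans (ϑ≈ d (ℕP.n≤1+n d)) (trans (*-congˡ partialSum-d) (*-identityʳ _)))
      , trans (ϑ≈ (suc d) ℕP.≤-refl) (trans (*-congˡ partialSum-suc-d) (zeroʳ _))

    recurrent⇒scaledPartialSum :
      1 ≤ d → ∀ ϑ → BetaRecurrentUpTo β d ϑ × ϑ 0 ≈ 0# × ϑ 1 ≈ ϑ d × ϑ (suc d) ≈ 0# →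
      ∀ i → i ≤ suc d → ϑ i ≈ ϑ 1 * partialSum i
    recurrent⇒scaledPartialSum 1≤d ϑ (ϑ-rec , ϑ₀ , ϑ₁≈ϑd , ϑd+1) i i≤ =
      x-y≈0⇒x≈y _ _ (betaRecurrent-boundary-vanish β 1≤d θ-betaGamma θ₀≉θd ψ-rec ψ₀ ψ₁ ψd ψd+1 i i≤)
      where
      ψ : ℕ → Carrier
      ψ j = ϑ j - ϑ 1 * partialSum j

      ψ-rec : BetaRecurrentUpTo β d ψ
      ψ-rec = betaRecurrent-- β ϑ-rec (betaRecurrent-* β (ϑ 1) partialSum-betaRecurrent)

      ψ₀ : ψ 0 ≈ 0#
      ψ₀ = x≈y⇒x-y≈0 (trans ϑ₀ (sym (zeroʳ _)))

      ψ₁ : ψ 1 ≈ 0#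
      ψ₁ = x≈y⇒x-y≈0 (sym (trans (*-congˡ partialSum-1) (*-identityʳ _)))

      ψd : ψ d ≈ 0#
      ψd = x≈y⇒x-y≈0 (trans (sym ϑ₁≈ϑd) (sym (trans (*-congˡ partialSum-d) (*-identityʳ _))))

      ψd+1 : ψ (suc d) ≈ 0#
      ψd+1 = x≈y⇒x-y≈0 (trans ϑd+1 (sym (trans (*-congˡ partialSum-suc-d) (zeroʳ _))))

proposition13p4 : ∀ {c ℓ} (F : Field c ℓ) → let open Field F in
    (d : ℕ) → 1 ≤ d → (β : Carrier) → (θ : ℕ → Carrier) →
    MutuallyDistinct d θ →
    BetaRecurrentUpTo β (d ∸ 1) θ →
    (ϑ : ℕ → Carrier) →
    ((∀ i → i ≤ suc d →
        ϑ i ≈ ϑ 1 * sumTo i (λ h → (θ h - θ (d ∸ h)) / (θ 0 - θ d)))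
     ⇔
     (BetaRecurrentUpTo β d ϑ × ϑ 0 ≈ 0# × ϑ 1 ≈ ϑ d × ϑ (suc d) ≈ 0#))
proposition13p4 F d 1≤d β θ distinct θ-rec ϑ =
  mk⇔ (scaledPartialSum⇒recurrent ϑ) (recurrent⇒scaledPartialSum 1≤d ϑ)
  where
  open Recurrence.PartialSums F d β θ (distinct 0 d z≤n ℕP.≤-refl (ℕP.<⇒≢ 1≤d)) θ-rec
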